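{- Let $b(n)$ be the number of non-Rascoe partitions of $n$ (with $b(0)=1$), and let $\sigma_2(q)=\sum_{n=0}^{\infty}\frac{(-1)^nq^{n^2}}{(-q;q)_n}$. Then for $|q|<1$, \[ \sum_{n=0}^{\infty}b(n)q^n=(-q;q)_{\infty}\,\sigma_2(q)=\sum_{n=0}^{\infty}(-1)^nq^{n^2}(-q^{n+1};q)_{\infty}. \]
   Context: A non-Rascoe partition of a positive integer $n$ is a partition of $n$ into distinct parts in which the number of parts is not itself a part; the empty partition is counted as the unique non-Rascoe partition of $0$, so $b(0)=1$. Notation: $(a;q)_0=1$, $(a;q)_n=\prod_{k=0}^{n-1}(1-aq^k)$, $(a;q)_\infty=\prod_{k=0}^{\infty}(1-aq^k)$ for $|q|<1$. -}

module Defs where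

open import Data.Nat as ℕ using (ℕ; zero; suc; _∸_; _<_; _>_; _≡ᵇ_; _≤ᵇ_)
open import Data.Integer as ℤ using (ℤ; +_; -_; _+_; _*_; _^_)
open import Data.Bool using (if_then_else_)
open import Data.List using (List; length)
open import Data.Nat.ListAction using (sum)
open import Data.List.Relation.Unary.All using (All)
open import Data.List.Relation.Unary.Linked using (Linked)
open import Data.List.Membership.Propositional using (_∉_)
open import Relation.Binary.PropositionalEquality using (_≡_)
open import Data.Product using (_×_)

DistinctPartition : ℕ → List ℕ → Set
DistinctPartition n ps = Linked _>_ ps × All (0 <_) ps × sum ps ≡ n

NonRascoe : ℕ → List ℕ → Set
NonRascoe n ps = DistinctPartition n ps × length ps ∉ ps

-- Formal power series in q over ℤ, as coefficient functions.

Series : Set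
Series = ℕ → ℤ

Σ≤ : ℕ → (ℕ → ℤ) → ℤ
Σ≤ zero    f = f 0
Σ≤ (suc n) f = Σ≤ n f + f (suc n)

_⊛_ : Series → Series → Series
(f ⊛ g) n = Σ≤ n (λ k → f k * g (n ∸ k))

one : Series
one zero    = + 1
one (suc _) = + 0

mono : ℤ → ℕ → Series
mono c e n = if e ≡ᵇ n then c else + 0

onePlusQ^ : ℕ → Series
onePlusQ^ k n = one n + mono (+ 1) k n

negPoch : ℕ → ℕ → Series
negPoch a zero    = one
negPoch a (suc m) = negPoch a m ⊛ onePlusQ^ (a ℕ.+ m)

-- (-q^a ; q)_∞ for a ≥ 1: the coefficient of q^n equals that of the
-- finite product (-q^a;q)_{n+1}, since the remaining factors are
-- 1 + O(q^{n+1}).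
negPochInf : ℕ → Series
negPochInf a n = negPoch a (suc n) n

-- Multiplicative inverse of a series f with f 0 = 1:
-- g 0 = 1, g m = - Σ_{k=1}^{m} f k * g (m - k).
-- invTab f N is correct on all indices ≤ N.
invTab : Series → ℕ → Series
invTab f zero    m = one m
invTab f (suc N) m =
  if m ℕ.≤ᵇ N then invTab f N m
  else - Σ≤ m (λ k → if k ≡ᵇ 0 then + 0 else f k * invTab f N (m ∸ k))

inv : Series → Series
inv f n = invTab f n n

-- Σ_{n ≥ 0} t n, for a family with t n = O(q^n) (q-adic convergence):
-- the coefficient of q^N only receives contributions from n ≤ N.
sumSeries : (ℕ → Series) → Series
sumSeries t N = Σ≤ N (λ n → t n N)

σ₂ : Series
σ₂ = sumSeries (λ n → mono ((- + 1) ^ n) (n ℕ.* n) ⊛ inv (negPoch 1 n))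

rhs : Series
rhs = sumSeries (λ n → mono ((- + 1) ^ n) (n ℕ.* n) ⊛ negPochInf (suc n))

{-# OPTIONS --safe #-}
module Submission where

-- Sort the partitions of n into distinct parts by their number r of parts: the non-Rascoe ones
-- are those that avoid r. Deleting a part t from a partition containing it leaves one of n − t
-- with one part fewer that avoids t, so by inclusion–exclusion, with d_j(q) the generating
-- function of partitions into j distinct parts,
--   Σ b(n) qⁿ = Σ_r Σ_{i≤r} (-1)^i q^{ir} d_{r-i}(q) = Σ_i (-1)^i q^{i²} Σ_j q^{ij} d_j(q),
-- and Σ_j z^j d_j(q) = (-zq;q)_∞ at z = q^i is (-q^{i+1};q)_∞. The σ₂ form follows termwise
-- from (-q;q)_∞ / (-q;q)_i = (-q^{i+1};q)_∞.

open import Defs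
open import Data.Nat using (ℕ)
open import Data.Integer using (+_)
open import Data.List using (List; length)
open import Data.List.Relation.Unary.Unique.Propositional using (Unique)
open import Data.List.Membership.Propositional using (_∈_)
open import Function.Bundles using (_⇔_)
open import Relation.Binary.PropositionalEquality using (_≡_)
open import Data.Product using (_×_)

open import Data.Bool using (Bool; true; false; if_then_else_; not; _∧_; _∨_)
open import Data.Bool.Properties using (T-≡; ∧-zeroʳ)
open import Data.Empty using (⊥-elim)
open import Data.Integer using (ℤ; -_; _+_; _*_; _^_; _-_)
import Data.Integer.Properties as ℤP
open import Data.List using ([]; _∷_; _++_; map; filter)
open import Data.List.Properties using (∷-injectiveʳ)
open import Data.List.Membership.Propositional using (_∉_)
open import Data.List.Membership.Propositional.Properties
  using (∈-++⁻; ∈-++⁺ˡ; ∈-++⁺ʳ; ∈-map⁻; ∈-map⁺; ∈-filter⁻; ∈-filter⁺)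
open import Data.List.Membership.Propositional.Properties.WithK using (unique∧set⇒bag)
open import Data.List.Relation.Binary.BagAndSetEquality using (∼bag⇒↭)
open import Data.List.Relation.Binary.Permutation.Propositional.Properties using (↭-length)
open import Data.List.Relation.Unary.All as All using (All; []; _∷_)
open import Data.List.Relation.Unary.AllPairs using ([]; _∷_)
open import Data.List.Relation.Unary.Any using (here; there)
open import Data.List.Relation.Unary.Linked as Linked using (Linked; []; [-]; _∷_)
open import Data.List.Relation.Unary.Linked.Properties using (Linked⇒AllPairs)
import Data.List.Relation.Unary.Unique.Propositional.Properties as Unique
open import Data.Nat as ℕ using (zero; suc; _∸_; _≡ᵇ_; _≤ᵇ_; _<_; _≤_; _>_; z≤n; s≤s)
import Data.Nat.Properties as ℕP
open import Data.Nat.ListAction using (sum)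
open import Data.Nat.Tactic.RingSolver using (solve-∀)
open import Data.Product using (_,_; proj₁; ∃-syntax; map₂)
open import Data.Sum using (_⊎_; inj₁; inj₂)
open import Function using (_∘_)
open import Function.Bundles using (Equivalence; mk⇔)
open import Function.Properties.Equivalence using () renaming (trans to ⇔-trans; sym to ⇔-sym)
open import Relation.Binary.PropositionalEquality
  using (_≢_; refl; sym; trans; cong; cong₂; subst; _≗_; module ≡-Reasoning)
open import Relation.Nullary using (¬_; does; ofʸ)
open import Relation.Nullary.Decidable using (dec-true; dec-false)
open import Relation.Unary using (Decidable)

open import Algebra.Properties.AbelianGroup ℤP.+-0-abelianGroup using (x≈z//y)
open import Algebra.Properties.CommutativeSemigroup ℤP.+-commutativeSemigroup
  using (interchange; x∙yz≈y∙xz)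
open import Data.List.Membership.DecPropositional ℕP._≟_ using (_∈?_; _∉?_)
open ≡-Reasoning

≤ᵇ-suc : ∀ a n → (suc a ≤ᵇ suc n) ≡ (a ≤ᵇ n)
≤ᵇ-suc zero    n = refl
≤ᵇ-suc (suc a) n = refl

≤⇒≤ᵇ≡true : ∀ {a n} → a ≤ n → (a ≤ᵇ n) ≡ true
≤⇒≤ᵇ≡true a≤n = Equivalence.to T-≡ (ℕP.≤⇒≤ᵇ a≤n)

>⇒≤ᵇ≡false : ∀ {a n} → n < a → (a ≤ᵇ n) ≡ false
>⇒≤ᵇ≡false {suc a} {zero}  _         = refl
>⇒≤ᵇ≡false {suc a} {suc n} (s≤s n<a) = trans (≤ᵇ-suc a n) (>⇒≤ᵇ≡false n<a)

≡ᵇ-refl : ∀ n → (n ≡ᵇ n) ≡ true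
≡ᵇ-refl n = dec-true (n ℕP.≟ n) refl

≢⇒≡ᵇ≡false : ∀ {m n} → m ≢ n → (m ≡ᵇ n) ≡ false
≢⇒≡ᵇ≡false {m} {n} = dec-false (m ℕP.≟ n)

≤⇒<+suc : ∀ {k m} b → k ≤ m → k < b ℕ.+ suc m
≤⇒<+suc {m = m} b k≤m = ℕP.≤-trans (s≤s k≤m) (ℕP.m≤n+m (suc m) b)

n≤n*n : ∀ n → n ≤ n ℕ.* n
n≤n*n zero    = z≤n
n≤n*n (suc n) = ℕP.m≤m*n (suc n) (suc n)

n∸i*i<j*i : ∀ n i j → n ∸ i < j → j ≤ n → n ∸ i ℕ.* i < j ℕ.* i
n∸i*i<j*i n zero    j n<j       j≤n = ⊥-elim (ℕP.<⇒≱ n<j j≤n)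
n∸i*i<j*i n (suc i) j n∸1+i<j _ =
  ℕP.≤-<-trans (ℕP.∸-monoʳ-≤ n (n≤n*n (suc i))) (ℕP.<-≤-trans n∸1+i<j (ℕP.m≤m*n j (suc i)))

𝟙 : Bool → ℤ
𝟙 true  = + 1
𝟙 false = + 0

𝟙-∧ : ∀ b c → 𝟙 (b ∧ c) ≡ (if c then 𝟙 b else + 0)
𝟙-∧ false false = refl
𝟙-∧ false true  = refl
𝟙-∧ true  false = refl
𝟙-∧ true  true  = refl

Σ≤-cong≤ : ∀ n {f g : ℕ → ℤ} → (∀ k → k ≤ n → f k ≡ g k) → Σ≤ n f ≡ Σ≤ n g
Σ≤-cong≤ zero    f≡g = f≡g 0 z≤n
Σ≤-cong≤ (suc n) f≡g =
  cong₂ _+_ (Σ≤-cong≤ n (λ k k≤n → f≡g k (ℕP.m≤n⇒m≤1+n k≤n))) (f≡g (suc n) ℕP.≤-refl)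

Σ≤-cong : ∀ n {f g : ℕ → ℤ} → f ≗ g → Σ≤ n f ≡ Σ≤ n g
Σ≤-cong n f≗g = Σ≤-cong≤ n (λ k _ → f≗g k)

Σ≤-zero : ∀ n {f : ℕ → ℤ} → f ≗ (λ _ → + 0) → Σ≤ n f ≡ + 0
Σ≤-zero zero    f≗0 = f≗0 0
Σ≤-zero (suc n) f≗0 = cong₂ _+_ (Σ≤-zero n f≗0) (f≗0 (suc n))

Σ≤-+ : ∀ n (f g : ℕ → ℤ) → Σ≤ n (λ k → f k + g k) ≡ Σ≤ n f + Σ≤ n g
Σ≤-+ zero    f g = refl
Σ≤-+ (suc n) f g =
  trans (cong (_+ (f (suc n) + g (suc n))) (Σ≤-+ n f g))
        (interchange (Σ≤ n f) (Σ≤ n g) (f (suc n)) (g (suc n)))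

Σ≤-*ˡ : ∀ n c (f : ℕ → ℤ) → c * Σ≤ n f ≡ Σ≤ n (λ k → c * f k)
Σ≤-*ˡ zero    c f = refl
Σ≤-*ˡ (suc n) c f =
  trans (ℤP.*-distribˡ-+ c (Σ≤ n f) (f (suc n))) (cong (_+ c * f (suc n)) (Σ≤-*ˡ n c f))

Σ≤-*ʳ : ∀ n c (f : ℕ → ℤ) → Σ≤ n f * c ≡ Σ≤ n (λ k → f k * c)
Σ≤-*ʳ n c f =
  trans (ℤP.*-comm (Σ≤ n f) c) (trans (Σ≤-*ˡ n c f) (Σ≤-cong n (λ k → ℤP.*-comm c (f k))))

Σ≤-neg : ∀ n (f : ℕ → ℤ) → - Σ≤ n f ≡ Σ≤ n (λ k → - f k)
Σ≤-neg zero    f = refl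
Σ≤-neg (suc n) f =
  trans (ℤP.neg-distrib-+ (Σ≤ n f) (f (suc n))) (cong (_+ - f (suc n)) (Σ≤-neg n f))

Σ≤-head : ∀ n (f : ℕ → ℤ) → Σ≤ (suc n) f ≡ f 0 + Σ≤ n (f ∘ suc)
Σ≤-head zero    f = refl
Σ≤-head (suc n) f =
  trans (cong (_+ f (suc (suc n))) (Σ≤-head n f)) (ℤP.+-assoc (f 0) _ _)

Σ≤-reverse : ∀ n (f : ℕ → ℤ) → Σ≤ n f ≡ Σ≤ n (λ k → f (n ∸ k))
Σ≤-reverse zero    f = refl
Σ≤-reverse (suc n) f = begin
  Σ≤ (suc n) f                           ≡⟨ Σ≤-head n f ⟩
  f 0 + Σ≤ n (f ∘ suc)                   ≡⟨ cong (_+_ (f 0)) (Σ≤-reverse n (f ∘ suc)) ⟩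
  f 0 + Σ≤ n (λ k → f (suc (n ∸ k)))     ≡⟨ cong (_+_ (f 0)) (Σ≤-cong≤ n (λ k k≤n → cong f (sym (ℕP.+-∸-assoc 1 k≤n)))) ⟩
  f 0 + Σ≤ n (λ k → f (suc n ∸ k))       ≡⟨ ℤP.+-comm (f 0) _ ⟩
  Σ≤ n (λ k → f (suc n ∸ k)) + f 0       ≡⟨ cong (λ i → Σ≤ n (λ k → f (suc n ∸ k)) + f i) (sym (ℕP.n∸n≡0 n)) ⟩
  Σ≤ (suc n) (λ k → f (suc n ∸ k))       ∎

Σ≤-comm : ∀ a b (h : ℕ → ℕ → ℤ) → Σ≤ a (λ i → Σ≤ b (h i)) ≡ Σ≤ b (λ j → Σ≤ a (λ i → h i j))
Σ≤-comm zero    b h = refl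
Σ≤-comm (suc a) b h =
  trans (cong (_+ Σ≤ b (h (suc a))) (Σ≤-comm a b h)) (sym (Σ≤-+ b _ (h (suc a))))

Σ≤-triangle : ∀ n (h : ℕ → ℕ → ℤ) →
  Σ≤ n (λ r → Σ≤ r (λ i → h i r)) ≡ Σ≤ n (λ i → Σ≤ (n ∸ i) (λ j → h i (i ℕ.+ j)))
Σ≤-triangle zero    h = refl
Σ≤-triangle (suc n) h = begin
  Σ≤ n (λ r → Σ≤ r (λ i → h i r)) + (Σ≤ n (λ i → h i (suc n)) + h (suc n) (suc n))
    ≡⟨ cong (_+ (Σ≤ n (λ i → h i (suc n)) + h (suc n) (suc n))) (Σ≤-triangle n h) ⟩
  T n + (Σ≤ n (λ i → h i (suc n)) + h (suc n) (suc n))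
    ≡⟨ sym (ℤP.+-assoc (T n) _ _) ⟩
  (T n + Σ≤ n (λ i → h i (suc n))) + h (suc n) (suc n)
    ≡⟨ cong₂ _+_ (sym (Σ≤-+ n _ _)) (cong (h (suc n)) (sym (ℕP.+-identityʳ (suc n)))) ⟩
  Σ≤ n (λ i → T′ n i + h i (suc n)) + h (suc n) (suc n ℕ.+ 0)
    ≡⟨ cong₂ _+_ (Σ≤-cong≤ n extend) (cong (λ d → Σ≤ d (λ j → h (suc n) (suc n ℕ.+ j))) (sym (ℕP.n∸n≡0 n))) ⟩
  Σ≤ (suc n) (T′ (suc n)) ∎
  where
  T′ : ℕ → ℕ → ℤ
  T′ m i = Σ≤ (m ∸ i) (λ j → h i (i ℕ.+ j))
  T : ℕ → ℤ
  T m = Σ≤ m (T′ m)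
  extend : ∀ i → i ≤ n → T′ n i + h i (suc n) ≡ T′ (suc n) i
  extend i i≤n = begin
    T′ n i + h i (suc n)
      ≡⟨ cong (λ m → T′ n i + h i m) (sym (trans (ℕP.+-suc i (n ∸ i)) (cong suc (ℕP.m+[n∸m]≡n i≤n)))) ⟩
    Σ≤ (suc (n ∸ i)) (λ j → h i (i ℕ.+ j))
      ≡⟨ cong (λ m → Σ≤ m (λ j → h i (i ℕ.+ j))) (sym (ℕP.+-∸-assoc 1 i≤n)) ⟩
    T′ (suc n) i ∎

Σ≤-extend : ∀ {a} b (f : ℕ → ℤ) → a ≤ b → (∀ k → a < k → k ≤ b → f k ≡ + 0) → Σ≤ a f ≡ Σ≤ b f
Σ≤-extend zero    f z≤n _ = refl
Σ≤-extend {a} (suc b) f a≤1+b f≡0 with ℕP.m≤n⇒m<n∨m≡n a≤1+b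
... | inj₂ refl      = refl
... | inj₁ (s≤s a≤b) = begin
  Σ≤ a f              ≡⟨ Σ≤-extend b f a≤b (λ k a<k k≤b → f≡0 k a<k (ℕP.m≤n⇒m≤1+n k≤b)) ⟩
  Σ≤ b f              ≡⟨ sym (ℤP.+-identityʳ _) ⟩
  Σ≤ b f + + 0        ≡⟨ cong (_+_ (Σ≤ b f)) (sym (f≡0 (suc b) (s≤s a≤b) ℕP.≤-refl)) ⟩
  Σ≤ b f + f (suc b)  ∎

Σ≤-δ : ∀ N e (h : ℕ → ℤ) → Σ≤ N (λ k → if e ≡ᵇ k then h k else + 0) ≡ (if e ≤ᵇ N then h e else + 0)
Σ≤-δ zero    zero    h = refl
Σ≤-δ zero    (suc e) h = refl
Σ≤-δ (suc N) zero    h =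
  trans (Σ≤-head N _) (trans (cong (_+_ (h 0)) (Σ≤-zero N (λ _ → refl))) (ℤP.+-identityʳ _))
Σ≤-δ (suc N) (suc e) h = begin
  Σ≤ (suc N) (λ k → if suc e ≡ᵇ k then h k else + 0)     ≡⟨ Σ≤-head N _ ⟩
  + 0 + Σ≤ N (λ k → if e ≡ᵇ k then h (suc k) else + 0)   ≡⟨ ℤP.+-identityˡ _ ⟩
  Σ≤ N (λ k → if e ≡ᵇ k then h (suc k) else + 0)         ≡⟨ Σ≤-δ N e (h ∘ suc) ⟩
  (if e ≤ᵇ N then h (suc e) else + 0)                    ≡⟨ cong (if_then h (suc e) else + 0) (sym (≤ᵇ-suc e N)) ⟩
  (if suc e ≤ᵇ suc N then h (suc e) else + 0)            ∎

ΣL : {A : Set} → (A → ℤ) → List A → ℤ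
ΣL f []       = + 0
ΣL f (x ∷ xs) = f x + ΣL f xs

ΣL-++ : ∀ {A : Set} (f : A → ℤ) xs ys → ΣL f (xs ++ ys) ≡ ΣL f xs + ΣL f ys
ΣL-++ f []       ys = sym (ℤP.+-identityˡ _)
ΣL-++ f (x ∷ xs) ys = trans (cong (_+_ (f x)) (ΣL-++ f xs ys)) (sym (ℤP.+-assoc (f x) _ _))

ΣL-map : ∀ {A B : Set} (f : B → ℤ) (g : A → B) xs → ΣL f (map g xs) ≡ ΣL (f ∘ g) xs
ΣL-map f g []       = refl
ΣL-map f g (x ∷ xs) = cong (_+_ (f (g x))) (ΣL-map f g xs)

ΣL-cong-∈ : ∀ {A : Set} {f g : A → ℤ} xs → (∀ {x} → x ∈ xs → f x ≡ g x) → ΣL f xs ≡ ΣL g xs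
ΣL-cong-∈ []       f≡g = refl
ΣL-cong-∈ (x ∷ xs) f≡g = cong₂ _+_ (f≡g (here refl)) (ΣL-cong-∈ xs (f≡g ∘ there))

ΣL-cong : ∀ {A : Set} {f g : A → ℤ} xs → f ≗ g → ΣL f xs ≡ ΣL g xs
ΣL-cong xs f≗g = ΣL-cong-∈ xs (λ {x} _ → f≗g x)

ΣL-zero : ∀ {A : Set} {f : A → ℤ} xs → f ≗ (λ _ → + 0) → ΣL f xs ≡ + 0
ΣL-zero []       f≗0 = refl
ΣL-zero (x ∷ xs) f≗0 = cong₂ _+_ (f≗0 x) (ΣL-zero xs f≗0)

ΣL-Σ≤ : ∀ {A : Set} R (f : ℕ → A → ℤ) xs →
  ΣL (λ x → Σ≤ R (λ r → f r x)) xs ≡ Σ≤ R (λ r → ΣL (f r) xs)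
ΣL-Σ≤ R f []       = sym (Σ≤-zero R (λ _ → refl))
ΣL-Σ≤ R f (x ∷ xs) = trans (cong (_+_ (Σ≤ R (λ r → f r x))) (ΣL-Σ≤ R f xs)) (sym (Σ≤-+ R _ _))

length-filter : ∀ {A : Set} {P : A → Set} (P? : Decidable P) xs →
  + length (filter P? xs) ≡ ΣL (𝟙 ∘ does ∘ P?) xs
length-filter P? []       = refl
length-filter P? (x ∷ xs) with does (P? x)
... | true  = cong (_+_ (+ 1)) (length-filter P? xs)
... | false = trans (length-filter P? xs) (sym (ℤP.+-identityˡ _))

length-unique-⇔ : ∀ {A : Set} {xs ys : List A} → Unique xs → Unique ys → (∀ z → (z ∈ xs) ⇔ (z ∈ ys)) →
  length xs ≡ length ys
length-unique-⇔ xs-unique ys-unique xs⇔ys =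
  ↭-length (∼bag⇒↭ (unique∧set⇒bag xs-unique ys-unique (λ {z} → xs⇔ys z)))

-- Formal power series

shift : ℕ → Series → Series
shift a f n = if a ≤ᵇ n then f (n ∸ a) else + 0

shift-> : ∀ {a n} f → n < a → shift a f n ≡ + 0
shift-> f n<a rewrite >⇒≤ᵇ≡false n<a = refl

shift-suc : ∀ a f n → shift (suc a) f (suc n) ≡ shift a f n
shift-suc a f n rewrite ≤ᵇ-suc a n = refl

shift-+ : ∀ a b f → shift (a ℕ.+ b) f ≗ shift a (shift b f)
shift-+ zero    b f n       = refl
shift-+ (suc a) b f zero    = refl
shift-+ (suc a) b f (suc n) =
  trans (shift-suc (a ℕ.+ b) f n) (trans (shift-+ a b f n) (sym (shift-suc a (shift b f) n)))

shift-comm : ∀ a b f → shift a (shift b f) ≗ shift b (shift a f)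
shift-comm a b f n =
  trans (sym (shift-+ a b f n)) (trans (cong (λ c → shift c f n) (ℕP.+-comm a b)) (shift-+ b a f n))

shift-cong-∸ : ∀ a n {f g} → f (n ∸ a) ≡ g (n ∸ a) → shift a f n ≡ shift a g n
shift-cong-∸ a n f≡g with a ≤ᵇ n
... | true  = f≡g
... | false = refl

shift-cong : ∀ a {f g} → f ≗ g → shift a f ≗ shift a g
shift-cong a {f} {g} f≗g n = shift-cong-∸ a n {f} {g} (f≗g (n ∸ a))

shift-zero : ∀ a → shift a (λ _ → + 0) ≗ (λ _ → + 0)
shift-zero a n with a ≤ᵇ n
... | true  = refl
... | false = refl

shift-distrib-+ : ∀ a f g → shift a (λ m → f m + g m) ≗ (λ n → shift a f n + shift a g n)
shift-distrib-+ a f g n with a ≤ᵇ n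
... | true  = refl
... | false = refl

shift-*ˡ : ∀ a c f → shift a (λ m → c * f m) ≗ (λ n → c * shift a f n)
shift-*ˡ a c f n with a ≤ᵇ n
... | true  = refl
... | false = sym (ℤP.*-zeroʳ c)

shift-Σ≤ : ∀ a J (f : ℕ → Series) →
  shift a (λ m → Σ≤ J (λ j → f j m)) ≗ (λ n → Σ≤ J (λ j → shift a (f j) n))
shift-Σ≤ a J f n with a ≤ᵇ n
... | true  = refl
... | false = sym (Σ≤-zero J (λ _ → refl))

⊛-congˡ : ∀ {f f′} g → f ≗ f′ → f ⊛ g ≗ f′ ⊛ g
⊛-congˡ g f≗f′ n = Σ≤-cong n (λ k → cong (_* g (n ∸ k)) (f≗f′ k))

⊛-congʳ≤ : ∀ f {g g′} n → (∀ k → k ≤ n → g k ≡ g′ k) → (f ⊛ g) n ≡ (f ⊛ g′) n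
⊛-congʳ≤ f n g≡g′ = Σ≤-cong≤ n (λ k _ → cong (f k *_) (g≡g′ (n ∸ k) (ℕP.m∸n≤m n k)))

⊛-congʳ : ∀ f {g g′} → g ≗ g′ → f ⊛ g ≗ f ⊛ g′
⊛-congʳ f g≗g′ n = ⊛-congʳ≤ f n (λ k _ → g≗g′ k)

⊛-comm : ∀ f g → f ⊛ g ≗ g ⊛ f
⊛-comm f g n = begin
  Σ≤ n (λ k → f k * g (n ∸ k))              ≡⟨ Σ≤-reverse n _ ⟩
  Σ≤ n (λ k → f (n ∸ k) * g (n ∸ (n ∸ k)))  ≡⟨ Σ≤-cong≤ n swap ⟩
  Σ≤ n (λ k → g k * f (n ∸ k))              ∎
  where
  swap : ∀ k → k ≤ n → f (n ∸ k) * g (n ∸ (n ∸ k)) ≡ g k * f (n ∸ k)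
  swap k k≤n = trans (cong (λ i → f (n ∸ k) * g i) (ℕP.m∸[m∸n]≡n k≤n)) (ℤP.*-comm (f (n ∸ k)) (g k))

⊛-assoc : ∀ f g h → (f ⊛ g) ⊛ h ≗ f ⊛ (g ⊛ h)
⊛-assoc f g h n = begin
  Σ≤ n (λ k → Σ≤ k (λ i → f i * g (k ∸ i)) * h (n ∸ k))
    ≡⟨ Σ≤-cong n (λ k → Σ≤-*ʳ k (h (n ∸ k)) _) ⟩
  Σ≤ n (λ k → Σ≤ k (λ i → f i * g (k ∸ i) * h (n ∸ k)))
    ≡⟨ Σ≤-triangle n (λ i k → f i * g (k ∸ i) * h (n ∸ k)) ⟩
  Σ≤ n (λ i → Σ≤ (n ∸ i) (λ j → f i * g (i ℕ.+ j ∸ i) * h (n ∸ (i ℕ.+ j))))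
    ≡⟨ Σ≤-cong n (λ i → Σ≤-cong (n ∸ i) (λ j → reindex i j)) ⟩
  Σ≤ n (λ i → Σ≤ (n ∸ i) (λ j → f i * (g j * h (n ∸ i ∸ j))))
    ≡⟨ Σ≤-cong n (λ i → sym (Σ≤-*ˡ (n ∸ i) (f i) _)) ⟩
  Σ≤ n (λ i → f i * Σ≤ (n ∸ i) (λ j → g j * h (n ∸ i ∸ j))) ∎
  where
  reindex : ∀ i j → f i * g (i ℕ.+ j ∸ i) * h (n ∸ (i ℕ.+ j)) ≡ f i * (g j * h (n ∸ i ∸ j))
  reindex i j = trans (cong₂ (λ a b → f i * g a * h b) (ℕP.m+n∸m≡n i j) (sym (ℕP.∸-+-assoc n i j)))
                      (ℤP.*-assoc (f i) _ _)

x⊛yz≗y⊛xz : ∀ f g h → f ⊛ (g ⊛ h) ≗ g ⊛ (f ⊛ h)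
x⊛yz≗y⊛xz f g h n = begin
  (f ⊛ (g ⊛ h)) n ≡⟨ sym (⊛-assoc f g h n) ⟩
  ((f ⊛ g) ⊛ h) n ≡⟨ ⊛-congˡ h (⊛-comm f g) n ⟩
  ((g ⊛ f) ⊛ h) n ≡⟨ ⊛-assoc g f h n ⟩
  (g ⊛ (f ⊛ h)) n ∎

⊛-identityˡ : ∀ f → one ⊛ f ≗ f
⊛-identityˡ f zero    = ℤP.*-identityˡ (f 0)
⊛-identityˡ f (suc n) = begin
  Σ≤ (suc n) (λ k → one k * f (suc n ∸ k))        ≡⟨ Σ≤-head n _ ⟩
  + 1 * f (suc n) + Σ≤ n (λ k → + 0 * f (n ∸ k))  ≡⟨ cong₂ _+_ (ℤP.*-identityˡ (f (suc n))) (Σ≤-zero n (λ _ → refl)) ⟩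
  f (suc n) + + 0                                 ≡⟨ ℤP.+-identityʳ _ ⟩
  f (suc n)                                       ∎

⊛-identityʳ : ∀ f → f ⊛ one ≗ f
⊛-identityʳ f n = trans (⊛-comm f one n) (⊛-identityˡ f n)

⊛-distribˡ-+ : ∀ f g h → f ⊛ (λ k → g k + h k) ≗ (λ n → (f ⊛ g) n + (f ⊛ h) n)
⊛-distribˡ-+ f g h n = trans (Σ≤-cong n (λ k → ℤP.*-distribˡ-+ (f k) _ _)) (Σ≤-+ n _ _)

mono-⊛ : ∀ c e g → mono c e ⊛ g ≗ shift e (λ m → c * g m)
mono-⊛ c e g n = trans (Σ≤-cong n (λ k → if-* {k} (e ≡ᵇ k))) (Σ≤-δ n e (λ k → c * g (n ∸ k)))
  where
  if-* : ∀ {k} b → (if b then c else + 0) * g (n ∸ k) ≡ (if b then c * g (n ∸ k) else + 0)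
  if-* true  = refl
  if-* false = refl

⊛-onePlusQ^ : ∀ f e → f ⊛ onePlusQ^ e ≗ (λ n → f n + shift e f n)
⊛-onePlusQ^ f e n = begin
  (f ⊛ onePlusQ^ e) n                   ≡⟨ ⊛-distribˡ-+ f one (mono (+ 1) e) n ⟩
  (f ⊛ one) n + (f ⊛ mono (+ 1) e) n    ≡⟨ cong₂ _+_ (⊛-identityʳ f n) (⊛-comm f (mono (+ 1) e) n) ⟩
  f n + (mono (+ 1) e ⊛ f) n            ≡⟨ cong (_+_ (f n)) (mono-⊛ (+ 1) e f n) ⟩
  f n + shift e (λ m → + 1 * f m) n     ≡⟨ cong (_+_ (f n)) (shift-cong e (λ m → ℤP.*-identityˡ (f m)) n) ⟩
  f n + shift e f n                     ∎

⊛-sumSeries : ∀ f (t : ℕ → Series) → (∀ k m → m < k → t k m ≡ + 0) →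
  f ⊛ sumSeries t ≗ sumSeries (λ k → f ⊛ t k)
⊛-sumSeries f t t-vanishes N = begin
  Σ≤ N (λ i → f i * Σ≤ (N ∸ i) (λ k → t k (N ∸ i)))
    ≡⟨ Σ≤-cong≤ N (λ i _ → cong (f i *_) (Σ≤-extend N _ (ℕP.m∸n≤m N i) (λ k i< _ → t-vanishes k (N ∸ i) i<))) ⟩
  Σ≤ N (λ i → f i * Σ≤ N (λ k → t k (N ∸ i)))
    ≡⟨ Σ≤-cong N (λ i → Σ≤-*ˡ N (f i) _) ⟩
  Σ≤ N (λ i → Σ≤ N (λ k → f i * t k (N ∸ i)))
    ≡⟨ Σ≤-comm N N _ ⟩
  Σ≤ N (λ k → (f ⊛ t k) N) ∎

invTab-inv : ∀ f N {m} → m ≤ N → invTab f N m ≡ inv f m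
invTab-inv f zero    z≤n   = refl
invTab-inv f (suc N) {m} m≤1+N with ℕP.m≤n⇒m<n∨m≡n m≤1+N
... | inj₂ refl      = refl
... | inj₁ (s≤s m≤N) rewrite ≤⇒≤ᵇ≡true m≤N = invTab-inv f N m≤N

inv-suc : ∀ f M → inv f (suc M) ≡ - Σ≤ M (λ k → f (suc k) * inv f (M ∸ k))
inv-suc f M = begin
  invTab f (suc M) (suc M)
    ≡⟨ cong (if_then invTab f M (suc M) else - Σ≤ (suc M) recurrence) (>⇒≤ᵇ≡false (ℕP.n<1+n M)) ⟩
  - Σ≤ (suc M) recurrence
    ≡⟨ cong -_ (trans (Σ≤-head M _) (ℤP.+-identityˡ _)) ⟩
  - Σ≤ M (λ k → f (suc k) * invTab f M (M ∸ k))
    ≡⟨ cong -_ (Σ≤-cong≤ M (λ k k≤M → cong (f (suc k) *_) (invTab-inv f M (ℕP.m∸n≤m M k)))) ⟩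
  - Σ≤ M (λ k → f (suc k) * inv f (M ∸ k)) ∎
  where
  recurrence : ℕ → ℤ
  recurrence k = if k ≡ᵇ 0 then + 0 else f k * invTab f M (suc M ∸ k)

⊛-inverseʳ : ∀ f → f 0 ≡ + 1 → f ⊛ inv f ≗ one
⊛-inverseʳ f f0≡1 zero    = trans (ℤP.*-identityʳ (f 0)) f0≡1
⊛-inverseʳ f f0≡1 (suc M) = begin
  Σ≤ (suc M) (λ k → f k * inv f (suc M ∸ k)) ≡⟨ Σ≤-head M _ ⟩
  f 0 * inv f (suc M) + X                    ≡⟨ cong₂ (λ a b → a * b + X) f0≡1 (inv-suc f M) ⟩
  + 1 * - X + X                              ≡⟨ cong (_+ X) (ℤP.*-identityˡ (- X)) ⟩
  - X + X                                    ≡⟨ ℤP.+-inverseˡ X ⟩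
  + 0                                        ∎
  where X = Σ≤ M (λ k → f (suc k) * inv f (M ∸ k))

negPoch-suc-stable : ∀ a K m → m < a ℕ.+ K → negPoch a (suc K) m ≡ negPoch a K m
negPoch-suc-stable a K m m<a+K = begin
  negPoch a (suc K) m                                    ≡⟨ ⊛-onePlusQ^ (negPoch a K) (a ℕ.+ K) m ⟩
  negPoch a K m + shift (a ℕ.+ K) (negPoch a K) m        ≡⟨ cong (_+_ (negPoch a K m)) (shift-> (negPoch a K) m<a+K) ⟩
  negPoch a K m + + 0                                    ≡⟨ ℤP.+-identityʳ _ ⟩
  negPoch a K m                                          ∎

negPoch-stable : ∀ a {K} K′ m → K ≤ K′ → m < a ℕ.+ K → negPoch a K′ m ≡ negPoch a K m
negPoch-stable a zero     m z≤n    _      = refl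
negPoch-stable a (suc K′) m K≤1+K′ m<a+K with ℕP.m≤n⇒m<n∨m≡n K≤1+K′
... | inj₂ refl      = refl
... | inj₁ (s≤s K≤K′) =
  trans (negPoch-suc-stable a K′ m (ℕP.<-≤-trans m<a+K (ℕP.+-monoʳ-≤ a K≤K′)))
        (negPoch-stable a K′ m K≤K′ m<a+K)

negPoch≡negPochInf : ∀ a K m → m < a ℕ.+ K → negPoch a K m ≡ negPochInf a m
negPoch≡negPochInf a K m m<a+K = begin
  negPoch a K m               ≡⟨ negPoch-stable a (K ℕ.+ suc m) m (ℕP.m≤m+n K (suc m)) m<a+K ⟨
  negPoch a (K ℕ.+ suc m) m   ≡⟨ negPoch-stable a (K ℕ.+ suc m) m (ℕP.m≤n+m (suc m) K) (≤⇒<+suc a ℕP.≤-refl) ⟩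
  negPoch a (suc m) m         ∎

negPoch-+ : ∀ a n K → negPoch a (n ℕ.+ K) ≗ negPoch a n ⊛ negPoch (a ℕ.+ n) K
negPoch-+ a n zero m rewrite ℕP.+-identityʳ n = sym (⊛-identityʳ (negPoch a n) m)
negPoch-+ a n (suc K) m rewrite ℕP.+-suc n K = begin
  (negPoch a (n ℕ.+ K) ⊛ onePlusQ^ (a ℕ.+ (n ℕ.+ K))) m
    ≡⟨ ⊛-congˡ (onePlusQ^ (a ℕ.+ (n ℕ.+ K))) (negPoch-+ a n K) m ⟩
  ((negPoch a n ⊛ negPoch (a ℕ.+ n) K) ⊛ onePlusQ^ (a ℕ.+ (n ℕ.+ K))) m
    ≡⟨ ⊛-assoc (negPoch a n) (negPoch (a ℕ.+ n) K) (onePlusQ^ (a ℕ.+ (n ℕ.+ K))) m ⟩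
  (negPoch a n ⊛ (negPoch (a ℕ.+ n) K ⊛ onePlusQ^ (a ℕ.+ (n ℕ.+ K)))) m
    ≡⟨ cong (λ e → (negPoch a n ⊛ (negPoch (a ℕ.+ n) K ⊛ onePlusQ^ e)) m) (sym (ℕP.+-assoc a n K)) ⟩
  (negPoch a n ⊛ negPoch (a ℕ.+ n) (suc K)) m ∎

negPoch-constant : ∀ a K → negPoch (suc a) K 0 ≡ + 1
negPoch-constant a zero    = refl
negPoch-constant a (suc K) = trans (ℤP.*-identityʳ _) (negPoch-constant a K)

negPochInf-split : ∀ a n → negPochInf a ≗ negPoch a n ⊛ negPochInf (a ℕ.+ n)
negPochInf-split a n m = begin
  negPoch a (suc m) m
    ≡⟨ negPoch-stable a (n ℕ.+ suc m) m (ℕP.m≤n+m (suc m) n) (≤⇒<+suc a ℕP.≤-refl) ⟨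
  negPoch a (n ℕ.+ suc m) m
    ≡⟨ negPoch-+ a n (suc m) m ⟩
  (negPoch a n ⊛ negPoch (a ℕ.+ n) (suc m)) m
    ≡⟨ ⊛-congʳ≤ (negPoch a n) m (λ k k≤m → negPoch≡negPochInf (a ℕ.+ n) (suc m) k (≤⇒<+suc (a ℕ.+ n) k≤m)) ⟩
  (negPoch a n ⊛ negPochInf (a ℕ.+ n)) m ∎

negPochInf-⊛-inv : ∀ a n → negPochInf (suc a) ⊛ inv (negPoch (suc a) n) ≗ negPochInf (suc a ℕ.+ n)
negPochInf-⊛-inv a n m = begin
  (negPochInf (suc a) ⊛ I) m ≡⟨ ⊛-congˡ I (negPochInf-split (suc a) n) m ⟩
  ((A ⊛ Aₙ) ⊛ I) m           ≡⟨ ⊛-congˡ I (⊛-comm A Aₙ) m ⟩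
  ((Aₙ ⊛ A) ⊛ I) m           ≡⟨ ⊛-assoc Aₙ A I m ⟩
  (Aₙ ⊛ (A ⊛ I)) m           ≡⟨ ⊛-congʳ Aₙ (⊛-inverseʳ A (negPoch-constant a n)) m ⟩
  (Aₙ ⊛ one) m               ≡⟨ ⊛-identityʳ Aₙ m ⟩
  Aₙ m                       ∎
  where
  A  = negPoch (suc a) n
  I  = inv A
  Aₙ = negPochInf (suc a ℕ.+ n)

sgn : ℕ → ℤ
sgn i = (- + 1) ^ i

negPochInf-⊛-σ₂ : negPochInf 1 ⊛ σ₂ ≗ rhs
negPochInf-⊛-σ₂ N = trans (⊛-sumSeries (negPochInf 1) term term-vanishes N) (Σ≤-cong N (λ k → cancel k N))
  where
  term : ℕ → Series
  term k = mono (sgn k) (k ℕ.* k) ⊛ inv (negPoch 1 k)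
  term-vanishes : ∀ k m → m < k → term k m ≡ + 0
  term-vanishes k m m<k = trans (mono-⊛ (sgn k) (k ℕ.* k) (inv (negPoch 1 k)) m)
                                (shift-> (λ n → sgn k * inv (negPoch 1 k) n) (ℕP.<-≤-trans m<k (n≤n*n k)))
  cancel : ∀ k → negPochInf 1 ⊛ term k ≗ mono (sgn k) (k ℕ.* k) ⊛ negPochInf (suc k)
  cancel k m = trans (x⊛yz≗y⊛xz (negPochInf 1) (mono (sgn k) (k ℕ.* k)) (inv (negPoch 1 k)) m)
                     (⊛-congʳ (mono (sgn k) (k ℕ.* k)) (negPochInf-⊛-inv 0 k) m)

-- Partitions into distinct parts

below-head : ∀ {x xs} → Linked _>_ (x ∷ xs) → All (_< x) xs
below-head l with Linked⇒AllPairs (λ y<x z<y → ℕP.<-trans z<y y<x) l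
... | xs<x ∷ _ = xs<x

∷-Linked : ∀ {x xs} → All (_< x) xs → Linked _>_ xs → Linked _>_ (x ∷ xs)
∷-Linked []        _  = [-]
∷-Linked (y<x ∷ _) l = y<x ∷ l

length≤sum : ∀ {ps} → All (0 <_) ps → length ps ≤ sum ps
length≤sum []          = z≤n
length≤sum (0<x ∷ pos) = ℕP.+-mono-≤ 0<x (length≤sum pos)

parts≤sum : ∀ ps → All (_≤ sum ps) ps
parts≤sum []       = []
parts≤sum (x ∷ xs) =
  ℕP.m≤m+n x (sum xs) ∷ All.map (λ y≤ → ℕP.≤-trans y≤ (ℕP.m≤n+m (sum xs) x)) (parts≤sum xs)

withPart : ℕ → (ℕ → List (List ℕ)) → ℕ → List (List ℕ)
withPart k P n = if k ≤ᵇ n then map (k ∷_) (P (n ∸ k)) else []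

distinctPartitions : ℕ → ℕ → List (List ℕ)
distinctPartitions zero    zero    = [] ∷ []
distinctPartitions zero    (suc n) = []
distinctPartitions (suc B) n       = distinctPartitions B n ++ withPart (suc B) (distinctPartitions B) n

∈-withPart⁻ : ∀ {k P n ps} → ps ∈ withPart k P n → ∃[ qs ] ps ≡ k ∷ qs × k ≤ n × qs ∈ P (n ∸ k)
∈-withPart⁻ {k} {P} {n} ps∈ with k ≤ᵇ n | ℕP.≤ᵇ-reflects-≤ k n
... | true  | ofʸ k≤n with ∈-map⁻ (k ∷_) ps∈
...   | qs , qs∈ , refl = qs , refl , k≤n , qs∈
∈-withPart⁻ () | false | _

∈-withPart⁺ : ∀ {k P n qs} → k ≤ n → qs ∈ P (n ∸ k) → k ∷ qs ∈ withPart k P n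
∈-withPart⁺ k≤n qs∈ rewrite ≤⇒≤ᵇ≡true k≤n = ∈-map⁺ (_ ∷_) qs∈

withPart-unique : ∀ k P n → (∀ m → Unique (P m)) → Unique (withPart k P n)
withPart-unique k P n P-unique with k ≤ᵇ n
... | true  = Unique.map⁺ ∷-injectiveʳ (P-unique (n ∸ k))
... | false = []

∈-distinctPartitions⁻ : ∀ B n {ps} → ps ∈ distinctPartitions B n → DistinctPartition n ps × All (_≤ B) ps
∈-distinctPartitions⁻ zero    zero (here refl) = ([] , [] , refl) , []
∈-distinctPartitions⁻ (suc B) n    ps∈ with ∈-++⁻ (distinctPartitions B n) ps∈
... | inj₁ ps∈ᴮ = map₂ (All.map ℕP.m≤n⇒m≤1+n) (∈-distinctPartitions⁻ B n ps∈ᴮ)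
... | inj₂ ps∈ʷ with ∈-withPart⁻ {suc B} {distinctPartitions B} {n} ps∈ʷ
...   | qs , refl , B<n , qs∈ with ∈-distinctPartitions⁻ B (n ∸ suc B) qs∈
...     | (l , pos , Σqs) , qs≤B =
  (∷-Linked (All.map s≤s qs≤B) l , s≤s z≤n ∷ pos , trans (cong (suc B ℕ.+_) Σqs) (ℕP.m+[n∸m]≡n B<n)) ,
  ℕP.≤-refl ∷ All.map ℕP.m≤n⇒m≤1+n qs≤B

∈-distinctPartitions⁺ : ∀ B n {ps} → DistinctPartition n ps → All (_≤ B) ps → ps ∈ distinctPartitions B n
∈-distinctPartitions⁺ zero    _ {[]}    (_ , _ , refl)       _          = here refl
∈-distinctPartitions⁺ zero    _ {_ ∷ _} (_ , 0<x ∷ _ , _)    (x≤0 ∷ _) = ⊥-elim (ℕP.<⇒≱ 0<x x≤0)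
∈-distinctPartitions⁺ (suc B) n {[]}    d                    []         =
  ∈-++⁺ˡ (∈-distinctPartitions⁺ B n d [])
∈-distinctPartitions⁺ (suc B) n {x ∷ xs} d@(l , pos , Σ≡n) (x≤1+B ∷ _) with ℕP.m≤n⇒m<n∨m≡n x≤1+B
... | inj₁ (s≤s x≤B) =
  ∈-++⁺ˡ (∈-distinctPartitions⁺ B n d (x≤B ∷ All.map (λ y<x → ℕP.<⇒≤ (ℕP.<-≤-trans y<x x≤B)) (below-head l)))
... | inj₂ refl =
  ∈-++⁺ʳ (distinctPartitions B n)
    (∈-withPart⁺ {P = distinctPartitions B} x≤n
      (∈-distinctPartitions⁺ B (n ∸ x) (Linked.tail l , All.tail pos , Σxs) (All.map ℕP.≤-pred (below-head l))))
  where
  x≤n : x ≤ n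
  x≤n = subst (x ≤_) Σ≡n (ℕP.m≤m+n x (sum xs))
  Σxs : sum xs ≡ n ∸ x
  Σxs = trans (sym (ℕP.m+n∸m≡n x (sum xs))) (cong (_∸ x) Σ≡n)

distinctPartitions-unique : ∀ B n → Unique (distinctPartitions B n)
distinctPartitions-unique zero    zero    = [] ∷ []
distinctPartitions-unique zero    (suc n) = []
distinctPartitions-unique (suc B) n       =
  Unique.++⁺ (distinctPartitions-unique B n)
             (withPart-unique (suc B) (distinctPartitions B) n (distinctPartitions-unique B))
             disjoint
  where
  disjoint : ∀ {ps} → ¬ (ps ∈ distinctPartitions B n × ps ∈ withPart (suc B) (distinctPartitions B) n)
  disjoint (ps∈ᴮ , ps∈ʷ) with ∈-withPart⁻ {suc B} {distinctPartitions B} {n} ps∈ʷ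
  ... | _ , refl , _ with ∈-distinctPartitions⁻ B n ps∈ᴮ
  ...   | _ , 1+B≤B ∷ _ = ℕP.1+n≰n 1+B≤B

ΣL-withPart : ∀ (w : List ℕ → ℤ) k P n → ΣL w (withPart k P n) ≡ shift k (λ m → ΣL (w ∘ (k ∷_)) (P m)) n
ΣL-withPart w k P n with k ≤ᵇ n
... | true  = ΣL-map w (k ∷_) (P (n ∸ k))
... | false = refl

ΣL-distinctPartitions-suc : ∀ (w : List ℕ → ℤ) B n →
  ΣL w (distinctPartitions (suc B) n) ≡
  ΣL w (distinctPartitions B n) + shift (suc B) (λ m → ΣL (w ∘ (suc B ∷_)) (distinctPartitions B m)) n
ΣL-distinctPartitions-suc w B n =
  trans (ΣL-++ w (distinctPartitions B n) _)
        (cong (_+_ (ΣL w (distinctPartitions B n))) (ΣL-withPart w (suc B) (distinctPartitions B) n))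

ΣL-distinctPartitions-suc-∌ : ∀ (w : List ℕ → ℤ) B n → (∀ ps → w (suc B ∷ ps) ≡ + 0) →
  ΣL w (distinctPartitions (suc B) n) ≡ ΣL w (distinctPartitions B n)
ΣL-distinctPartitions-suc-∌ w B n w≡0 = begin
  ΣL w (distinctPartitions (suc B) n)
    ≡⟨ ΣL-distinctPartitions-suc w B n ⟩
  ΣL w (distinctPartitions B n) + shift (suc B) (λ m → ΣL (w ∘ (suc B ∷_)) (distinctPartitions B m)) n
    ≡⟨ cong (_+_ (ΣL w (distinctPartitions B n)))
            (trans (shift-cong (suc B) (λ m → ΣL-zero (distinctPartitions B m) w≡0) n) (shift-zero (suc B) n)) ⟩
  ΣL w (distinctPartitions B n) + + 0
    ≡⟨ ℤP.+-identityʳ _ ⟩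
  ΣL w (distinctPartitions B n) ∎

-- Counting by the number of parts

#dp : ℕ → ℕ → Series
#dp B r n = ΣL (λ ps → 𝟙 (length ps ≡ᵇ r)) (distinctPartitions B n)

#dp∌ : ℕ → ℕ → ℕ → Series
#dp∌ t B r n = ΣL (λ ps → 𝟙 (does (t ∉? ps) ∧ (length ps ≡ᵇ r))) (distinctPartitions B n)

#dp-suc-zero : ∀ B n → #dp (suc B) 0 n ≡ #dp B 0 n
#dp-suc-zero B n = ΣL-distinctPartitions-suc-∌ _ B n (λ _ → refl)

#dp-suc-suc : ∀ B r n → #dp (suc B) (suc r) n ≡ #dp B (suc r) n + shift (suc B) (#dp B r) n
#dp-suc-suc B r = ΣL-distinctPartitions-suc _ B

#dp∌-suc-suc : ∀ {t} B r n → t ≢ suc B →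
  #dp∌ t (suc B) (suc r) n ≡ #dp∌ t B (suc r) n + shift (suc B) (#dp∌ t B r) n
#dp∌-suc-suc {t} B r n t≢1+B =
  trans (ΣL-distinctPartitions-suc _ B n)
        (cong (_+_ (#dp∌ t B (suc r) n)) (shift-cong (suc B) (λ m → ΣL-cong (distinctPartitions B m) drop-part) n))
  where
  drop-part : ∀ ps →
    𝟙 (not ((t ≡ᵇ suc B) ∨ does (t ∈? ps)) ∧ (length ps ≡ᵇ r)) ≡ 𝟙 (does (t ∉? ps) ∧ (length ps ≡ᵇ r))
  drop-part ps = cong (λ b → 𝟙 (not (b ∨ does (t ∈? ps)) ∧ (length ps ≡ᵇ r))) (≢⇒≡ᵇ≡false t≢1+B)

#dp∌-self : ∀ B r n → #dp∌ (suc B) (suc B) r n ≡ #dp∌ (suc B) B r n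
#dp∌-self B r n = ΣL-distinctPartitions-suc-∌ _ B n contains
  where
  contains : ∀ ps → 𝟙 (not ((suc B ≡ᵇ suc B) ∨ does (suc B ∈? ps)) ∧ (suc (length ps) ≡ᵇ r)) ≡ + 0
  contains ps = cong (λ b → 𝟙 (not (b ∨ does (suc B ∈? ps)) ∧ (suc (length ps) ≡ᵇ r))) (≡ᵇ-refl (suc B))

#dp∌-zero-parts : ∀ t B n → #dp∌ t B 0 n ≡ #dp B 0 n
#dp∌-zero-parts t B n = ΣL-cong (distinctPartitions B n) λ { [] → refl ; (_ ∷ _) → cong 𝟙 (∧-zeroʳ _) }

#dp∌-absent : ∀ {t} B r n → t ≡ 0 ⊎ B < t → #dp∌ t B r n ≡ #dp B r n
#dp∌-absent {t} B r n t-absent = ΣL-cong-∈ (distinctPartitions B n) (λ ps∈ →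
  cong (λ b → 𝟙 (not b ∧ _)) (dec-false (t ∈? _) (t∉ t-absent (∈-distinctPartitions⁻ B n ps∈))))
  where
  t∉ : ∀ {ps} → t ≡ 0 ⊎ B < t → DistinctPartition n ps × All (_≤ B) ps → t ∉ ps
  t∉ (inj₁ t≡0) ((_ , pos , _) , _) t∈ps = ℕP.<⇒≢ (All.lookup pos t∈ps) (sym t≡0)
  t∉ (inj₂ B<t) (_ , ps≤B)          t∈ps = ℕP.<⇒≱ B<t (All.lookup ps≤B t∈ps)

#dp-split-top : ∀ B r n →
  #dp (suc B) (suc r) n ≡ #dp∌ (suc B) (suc B) (suc r) n + shift (suc B) (#dp∌ (suc B) (suc B) r) n
#dp-split-top B r n =
  trans (#dp-suc-suc B r n) (cong₂ _+_ (sym (avoid (suc r) n)) (shift-cong (suc B) (λ m → sym (avoid r m)) n))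
  where
  avoid : ∀ r m → #dp∌ (suc B) (suc B) r m ≡ #dp B r m
  avoid r m = trans (#dp∌-self B r m) (#dp∌-absent B r m (inj₂ (ℕP.n<1+n B)))

#dp-split-step : ∀ {t} B → t ≤ B →
  (∀ r n → #dp B (suc r) n ≡ #dp∌ t B (suc r) n + shift t (#dp∌ t B r) n) →
  ∀ r n → #dp (suc B) (suc r) n ≡ #dp∌ t (suc B) (suc r) n + shift t (#dp∌ t (suc B) r) n
#dp-split-step {t} B t≤B split r n = begin
  #dp (suc B) (suc r) n                                                  ≡⟨ #dp-suc-suc B r n ⟩
  #dp B (suc r) n + shift (suc B) (#dp B r) n                            ≡⟨ cong (_+ shift (suc B) (#dp B r) n) (split r n) ⟩
  (#dp∌ t B (suc r) n + shift t A n) + shift (suc B) (#dp B r) n         ≡⟨ ℤP.+-assoc (#dp∌ t B (suc r) n) _ _ ⟩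
  #dp∌ t B (suc r) n + (shift t A n + shift (suc B) (#dp B r) n)         ≡⟨ cong (_+_ (#dp∌ t B (suc r) n)) (swap r) ⟩
  #dp∌ t B (suc r) n + (shift (suc B) A n + shift t (#dp∌ t (suc B) r) n) ≡⟨ ℤP.+-assoc (#dp∌ t B (suc r) n) _ _ ⟨
  (#dp∌ t B (suc r) n + shift (suc B) A n) + shift t (#dp∌ t (suc B) r) n ≡⟨ cong (_+ shift t (#dp∌ t (suc B) r) n) (#dp∌-suc-suc B r n t≢1+B) ⟨
  #dp∌ t (suc B) (suc r) n + shift t (#dp∌ t (suc B) r) n                 ∎
  where
  A = #dp∌ t B r
  t≢1+B = ℕP.<⇒≢ (s≤s t≤B)
  zero-parts : ∀ m → #dp∌ t B 0 m ≡ #dp∌ t (suc B) 0 m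
  zero-parts m = trans (#dp∌-zero-parts t B m) (trans (sym (#dp-suc-zero B m)) (sym (#dp∌-zero-parts t (suc B) m)))
  swap : ∀ r → shift t (#dp∌ t B r) n + shift (suc B) (#dp B r) n ≡
               shift (suc B) (#dp∌ t B r) n + shift t (#dp∌ t (suc B) r) n
  swap zero = trans (ℤP.+-comm (shift t (#dp∌ t B 0) n) (shift (suc B) (#dp B 0) n))
                    (cong₂ _+_ (shift-cong (suc B) (λ m → sym (#dp∌-zero-parts t B m)) n) (shift-cong t zero-parts n))
  swap (suc r) = begin
    shift t A′ n + shift (suc B) (#dp B (suc r)) n
      ≡⟨ cong (_+_ (shift t A′ n)) (shift-cong (suc B) (split r) n) ⟩
    shift t A′ n + shift (suc B) (λ m → A′ m + shift t C m) n
      ≡⟨ cong (_+_ (shift t A′ n)) (shift-distrib-+ (suc B) A′ (shift t C) n) ⟩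
    shift t A′ n + (shift (suc B) A′ n + shift (suc B) (shift t C) n)
      ≡⟨ x∙yz≈y∙xz (shift t A′ n) (shift (suc B) A′ n) (shift (suc B) (shift t C) n) ⟩
    shift (suc B) A′ n + (shift t A′ n + shift (suc B) (shift t C) n)
      ≡⟨ cong (λ x → shift (suc B) A′ n + (shift t A′ n + x)) (shift-comm (suc B) t C n) ⟩
    shift (suc B) A′ n + (shift t A′ n + shift t (shift (suc B) C) n)
      ≡⟨ cong (_+_ (shift (suc B) A′ n)) (shift-distrib-+ t A′ (shift (suc B) C) n) ⟨
    shift (suc B) A′ n + shift t (λ m → A′ m + shift (suc B) C m) n
      ≡⟨ cong (_+_ (shift (suc B) A′ n)) (shift-cong t (λ m → #dp∌-suc-suc B r m t≢1+B) n) ⟨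
    shift (suc B) A′ n + shift t (#dp∌ t (suc B) (suc r)) n ∎
    where
    A′ = #dp∌ t B (suc r)
    C  = #dp∌ t B r

#dp-split : ∀ {t} B r n → 1 ≤ t → t ≤ B → #dp B (suc r) n ≡ #dp∌ t B (suc r) n + shift t (#dp∌ t B r) n
#dp-split {suc _} zero    r n _   ()
#dp-split         (suc B) r n 1≤t t≤1+B with ℕP.m≤n⇒m<n∨m≡n t≤1+B
... | inj₂ refl      = #dp-split-top B r n
... | inj₁ (s≤s t≤B) = #dp-split-step B t≤B (λ r n → #dp-split B r n 1≤t t≤B) r n

#dp∌-alternating : ∀ {t} B r n → 1 ≤ t → t ≤ B →
  #dp∌ t B r n ≡ Σ≤ r (λ i → sgn i * shift (i ℕ.* t) (#dp B (r ∸ i)) n)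
#dp∌-alternating     B zero    n _   _   = trans (#dp∌-zero-parts _ B n) (sym (ℤP.*-identityˡ _))
#dp∌-alternating {t} B (suc r) n 1≤t t≤B = begin
  #dp∌ t B (suc r) n
    ≡⟨ x≈z//y _ _ _ (sym (#dp-split B r n 1≤t t≤B)) ⟩
  N - shift t (#dp∌ t B r) n
    ≡⟨ cong (_-_ N) (shift-cong t (λ m → #dp∌-alternating B r m 1≤t t≤B) n) ⟩
  N - shift t (λ m → Σ≤ r (λ i → sgn i * shift (i ℕ.* t) (#dp B (r ∸ i)) m)) n
    ≡⟨ cong (_-_ N) (shift-Σ≤ t r (λ i m → sgn i * shift (i ℕ.* t) (#dp B (r ∸ i)) m) n) ⟩
  N - Σ≤ r (λ i → shift t (λ m → sgn i * shift (i ℕ.* t) (#dp B (r ∸ i)) m) n)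
    ≡⟨ cong (_-_ N) (Σ≤-cong r shift-term) ⟩
  N - Σ≤ r (λ i → sgn i * T i)
    ≡⟨ cong₂ _+_ (sym (ℤP.*-identityˡ N))
                 (trans (Σ≤-neg r (λ i → sgn i * T i)) (Σ≤-cong r (λ i → ℤP.neg-distribˡ-* (sgn i) (T i)))) ⟩
  + 1 * N + Σ≤ r (λ i → - sgn i * T i)
    ≡⟨ cong (_+_ (+ 1 * N)) (Σ≤-cong r (λ i → cong (_* T i) (sym (ℤP.-1*i≡-i (sgn i))))) ⟩
  + 1 * N + Σ≤ r (λ i → sgn (suc i) * T i)
    ≡⟨ Σ≤-head r (λ i → sgn i * shift (i ℕ.* t) (#dp B (suc r ∸ i)) n) ⟨
  Σ≤ (suc r) (λ i → sgn i * shift (i ℕ.* t) (#dp B (suc r ∸ i)) n) ∎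
  where
  N : ℤ
  N = #dp B (suc r) n
  T : ℕ → ℤ
  T i = shift (suc i ℕ.* t) (#dp B (r ∸ i)) n
  shift-term : ∀ i → shift t (λ m → sgn i * shift (i ℕ.* t) (#dp B (r ∸ i)) m) n ≡ sgn i * T i
  shift-term i = trans (shift-*ˡ t (sgn i) (shift (i ℕ.* t) (#dp B (r ∸ i))) n)
                       (cong (sgn i *_) (sym (shift-+ t (i ℕ.* t) (#dp B (r ∸ i)) n)))

#dp-empty-zero : #dp 0 0 ≗ one
#dp-empty-zero zero    = refl
#dp-empty-zero (suc n) = refl

#dp-empty-suc : ∀ r → #dp 0 (suc r) ≗ (λ _ → + 0)
#dp-empty-suc r zero    = refl
#dp-empty-suc r (suc n) = refl

shift-#dp-suc-suc : ∀ i K j → shift (suc j ℕ.* i) (#dp (suc K) (suc j)) ≗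
  (λ m → shift (suc j ℕ.* i) (#dp K (suc j)) m + shift (suc i ℕ.+ K) (shift (j ℕ.* i) (#dp K j)) m)
shift-#dp-suc-suc i K j m = begin
  shift (suc j ℕ.* i) (#dp (suc K) (suc j)) m
    ≡⟨ shift-cong (suc j ℕ.* i) (#dp-suc-suc K j) m ⟩
  shift (suc j ℕ.* i) (λ w → #dp K (suc j) w + shift (suc K) (#dp K j) w) m
    ≡⟨ shift-distrib-+ (suc j ℕ.* i) (#dp K (suc j)) (shift (suc K) (#dp K j)) m ⟩
  S + shift (suc j ℕ.* i) (shift (suc K) (#dp K j)) m
    ≡⟨ cong (_+_ S) (shift-+ (suc j ℕ.* i) (suc K) (#dp K j) m) ⟨
  S + shift (suc j ℕ.* i ℕ.+ suc K) (#dp K j) m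
    ≡⟨ cong (λ e → S + shift e (#dp K j) m) (exponent i j K) ⟩
  S + shift (suc i ℕ.+ K ℕ.+ j ℕ.* i) (#dp K j) m
    ≡⟨ cong (_+_ S) (shift-+ (suc i ℕ.+ K) (j ℕ.* i) (#dp K j) m) ⟩
  S + shift (suc i ℕ.+ K) (shift (j ℕ.* i) (#dp K j)) m ∎
  where
  S = shift (suc j ℕ.* i) (#dp K (suc j)) m
  exponent : ∀ i j K → suc j ℕ.* i ℕ.+ suc K ≡ suc i ℕ.+ K ℕ.+ j ℕ.* i
  exponent = solve-∀

-- Σ_j #dp K j · z^j = ∏_{k=1}^{K} (1 + z q^k), evaluated at z = q^i.
Σ-shift-#dp≡negPoch : ∀ i K J m → K ≤ J → Σ≤ J (λ j → shift (j ℕ.* i) (#dp K j) m) ≡ negPoch (suc i) K m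
Σ-shift-#dp≡negPoch i zero J m _ = begin
  Σ≤ J (λ j → shift (j ℕ.* i) (#dp 0 j) m) ≡⟨ Σ≤-extend J (λ j → shift (j ℕ.* i) (#dp 0 j) m) z≤n no-parts ⟨
  #dp 0 0 m                                ≡⟨ #dp-empty-zero m ⟩
  one m                                    ∎
  where
  no-parts : ∀ j → 0 < j → j ≤ J → shift (j ℕ.* i) (#dp 0 j) m ≡ + 0
  no-parts (suc r) _ _ = trans (shift-cong (suc r ℕ.* i) (#dp-empty-suc r) m) (shift-zero (suc r ℕ.* i) m)
Σ-shift-#dp≡negPoch i (suc K) (suc J) m (s≤s K≤J) = begin
  Σ≤ (suc J) (λ j → shift (j ℕ.* i) (#dp (suc K) j) m)
    ≡⟨ Σ≤-head J (λ j → shift (j ℕ.* i) (#dp (suc K) j) m) ⟩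
  #dp (suc K) 0 m + Σ≤ J (λ j → shift (suc j ℕ.* i) (#dp (suc K) (suc j)) m)
    ≡⟨ cong₂ _+_ (#dp-suc-zero K m) (Σ≤-cong J (λ j → shift-#dp-suc-suc i K j m)) ⟩
  #dp K 0 m + Σ≤ J (λ j → S j + shift (suc i ℕ.+ K) (G j) m)
    ≡⟨ cong (_+_ (#dp K 0 m)) (Σ≤-+ J S (λ j → shift (suc i ℕ.+ K) (G j) m)) ⟩
  #dp K 0 m + (Σ≤ J S + Σ≤ J (λ j → shift (suc i ℕ.+ K) (G j) m))
    ≡⟨ ℤP.+-assoc (#dp K 0 m) (Σ≤ J S) _ ⟨
  (#dp K 0 m + Σ≤ J S) + Σ≤ J (λ j → shift (suc i ℕ.+ K) (G j) m)
    ≡⟨ cong₂ _+_ (Σ≤-head J (λ j → G j m)) (shift-Σ≤ (suc i ℕ.+ K) J G m) ⟨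
  Σ≤ (suc J) (λ j → G j m) + shift (suc i ℕ.+ K) (λ w → Σ≤ J (λ j → G j w)) m
    ≡⟨ cong₂ _+_ (Σ-shift-#dp≡negPoch i K (suc J) m (ℕP.m≤n⇒m≤1+n K≤J))
                 (shift-cong (suc i ℕ.+ K) (λ w → Σ-shift-#dp≡negPoch i K J w K≤J) m) ⟩
  negPoch (suc i) K m + shift (suc i ℕ.+ K) (negPoch (suc i) K) m
    ≡⟨ ⊛-onePlusQ^ (negPoch (suc i) K) (suc i ℕ.+ K) m ⟨
  negPoch (suc i) (suc K) m ∎
  where
  G : ℕ → Series
  G j = shift (j ℕ.* i) (#dp K j)
  S : ℕ → ℤ
  S j = G (suc j) m

Σ-shift-#dp≡negPochInf : ∀ n i →
  Σ≤ (n ∸ i) (λ j → shift (j ℕ.* i) (#dp n j) (n ∸ i ℕ.* i)) ≡ negPochInf (suc i) (n ∸ i ℕ.* i)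
Σ-shift-#dp≡negPochInf n i = begin
  Σ≤ (n ∸ i) (λ j → shift (j ℕ.* i) (#dp n j) m)
    ≡⟨ Σ≤-extend n _ (ℕP.m∸n≤m n i) too-many-parts ⟩
  Σ≤ n (λ j → shift (j ℕ.* i) (#dp n j) m)
    ≡⟨ Σ-shift-#dp≡negPoch i n n m ℕP.≤-refl ⟩
  negPoch (suc i) n m
    ≡⟨ negPoch≡negPochInf (suc i) n m (s≤s (ℕP.≤-trans (ℕP.m∸n≤m n (i ℕ.* i)) (ℕP.m≤n+m n i))) ⟩
  negPochInf (suc i) m ∎
  where
  m = n ∸ i ℕ.* i
  too-many-parts : ∀ j → n ∸ i < j → j ≤ n → shift (j ℕ.* i) (#dp n j) m ≡ + 0
  too-many-parts j n∸i<j j≤n = shift-> (#dp n j) (n∸i*i<j*i n i j n∸i<j j≤n)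

Σ-#dp∌≡rhs : ∀ n → Σ≤ n (λ r → #dp∌ r n r n) ≡ rhs n
Σ-#dp∌≡rhs n = begin
  Σ≤ n (λ r → #dp∌ r n r n)                                   ≡⟨ Σ≤-cong≤ n alternate ⟩
  Σ≤ n (λ r → Σ≤ r (λ i → H i r))                             ≡⟨ Σ≤-triangle n H ⟩
  Σ≤ n (λ i → Σ≤ (n ∸ i) (λ j → H i (i ℕ.+ j)))               ≡⟨ Σ≤-cong n collect ⟩
  Σ≤ n (λ i → sgn i * shift (i ℕ.* i) (negPochInf (suc i)) n) ≡⟨ Σ≤-cong n monomial ⟨
  rhs n                                                       ∎
  where
  H : ℕ → ℕ → ℤ
  H i r = sgn i * shift (i ℕ.* r) (#dp n (r ∸ i)) n
  alternate : ∀ r → r ≤ n → #dp∌ r n r n ≡ Σ≤ r (λ i → H i r)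
  alternate zero    _   = trans (#dp∌-zero-parts 0 n n) (sym (ℤP.*-identityˡ _))
  alternate (suc r) r<n = #dp∌-alternating n (suc r) n (s≤s z≤n) r<n
  collect : ∀ i → Σ≤ (n ∸ i) (λ j → H i (i ℕ.+ j)) ≡ sgn i * shift (i ℕ.* i) (negPochInf (suc i)) n
  collect i = begin
    Σ≤ (n ∸ i) (λ j → sgn i * shift (i ℕ.* (i ℕ.+ j)) (#dp n (i ℕ.+ j ∸ i)) n)
      ≡⟨ Σ≤-*ˡ (n ∸ i) (sgn i) _ ⟨
    sgn i * Σ≤ (n ∸ i) (λ j → shift (i ℕ.* (i ℕ.+ j)) (#dp n (i ℕ.+ j ∸ i)) n)
      ≡⟨ cong (sgn i *_) (Σ≤-cong (n ∸ i) split-exponent) ⟩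
    sgn i * Σ≤ (n ∸ i) (λ j → shift (i ℕ.* i) (shift (j ℕ.* i) (#dp n j)) n)
      ≡⟨ cong (sgn i *_) (shift-Σ≤ (i ℕ.* i) (n ∸ i) (λ j → shift (j ℕ.* i) (#dp n j)) n) ⟨
    sgn i * shift (i ℕ.* i) (λ m → Σ≤ (n ∸ i) (λ j → shift (j ℕ.* i) (#dp n j) m)) n
      ≡⟨ cong (sgn i *_) (shift-cong-∸ (i ℕ.* i) n {λ m → Σ≤ (n ∸ i) (λ j → shift (j ℕ.* i) (#dp n j) m)}
                                                  {negPochInf (suc i)} (Σ-shift-#dp≡negPochInf n i)) ⟩
    sgn i * shift (i ℕ.* i) (negPochInf (suc i)) n ∎
    where
    split-exponent : ∀ j →
      shift (i ℕ.* (i ℕ.+ j)) (#dp n (i ℕ.+ j ∸ i)) n ≡ shift (i ℕ.* i) (shift (j ℕ.* i) (#dp n j)) n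
    split-exponent j = trans (cong₂ (λ e r → shift e (#dp n r) n)
                                    (trans (ℕP.*-distribˡ-+ i i j) (cong (i ℕ.* i ℕ.+_) (ℕP.*-comm i j)))
                                    (ℕP.m+n∸m≡n i j))
                             (shift-+ (i ℕ.* i) (j ℕ.* i) (#dp n j) n)
  monomial : ∀ i → (mono (sgn i) (i ℕ.* i) ⊛ negPochInf (suc i)) n ≡ sgn i * shift (i ℕ.* i) (negPochInf (suc i)) n
  monomial i = trans (mono-⊛ (sgn i) (i ℕ.* i) (negPochInf (suc i)) n)
                     (shift-*ˡ (i ℕ.* i) (sgn i) (negPochInf (suc i)) n)

-- Non-Rascoe partitions

nonRascoePartitions : ℕ → List (List ℕ)
nonRascoePartitions n = filter (λ ps → length ps ∉? ps) (distinctPartitions n n)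

∈-nonRascoePartitions : ∀ n ps → (ps ∈ nonRascoePartitions n) ⇔ NonRascoe n ps
∈-nonRascoePartitions n ps = mk⇔ to from
  where
  to : ps ∈ nonRascoePartitions n → NonRascoe n ps
  to ps∈ with ∈-filter⁻ (λ ps → length ps ∉? ps) ps∈
  ... | ps∈dp , l∉ps = proj₁ (∈-distinctPartitions⁻ n n ps∈dp) , l∉ps
  from : NonRascoe n ps → ps ∈ nonRascoePartitions n
  from (d@(_ , _ , Σ≡n) , l∉ps) =
    ∈-filter⁺ (λ ps → length ps ∉? ps)
              (∈-distinctPartitions⁺ n n d (subst (λ s → All (_≤ s) ps) Σ≡n (parts≤sum ps))) l∉ps

nonRascoePartitions-unique : ∀ n → Unique (nonRascoePartitions n)
nonRascoePartitions-unique n = Unique.filter⁺ (λ ps → length ps ∉? ps) (distinctPartitions-unique n n)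

length-nonRascoePartitions : ∀ n → + length (nonRascoePartitions n) ≡ Σ≤ n (λ r → #dp∌ r n r n)
length-nonRascoePartitions n = begin
  + length (nonRascoePartitions n)
    ≡⟨ length-filter (λ ps → length ps ∉? ps) (distinctPartitions n n) ⟩
  ΣL (λ ps → 𝟙 (does (length ps ∉? ps))) (distinctPartitions n n)
    ≡⟨ ΣL-cong-∈ (distinctPartitions n n) (λ {ps} ps∈ → sym (split-by-length {ps} (length≤n ps∈))) ⟩
  ΣL (λ ps → Σ≤ n (λ r → 𝟙 (does (r ∉? ps) ∧ (length ps ≡ᵇ r)))) (distinctPartitions n n)
    ≡⟨ ΣL-Σ≤ n (λ r ps → 𝟙 (does (r ∉? ps) ∧ (length ps ≡ᵇ r))) (distinctPartitions n n) ⟩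
  Σ≤ n (λ r → #dp∌ r n r n) ∎
  where
  length≤n : ∀ {ps} → ps ∈ distinctPartitions n n → length ps ≤ n
  length≤n {ps} ps∈ with ∈-distinctPartitions⁻ n n ps∈
  ... | (_ , pos , Σ≡n) , _ = subst (length ps ≤_) Σ≡n (length≤sum pos)
  split-by-length : ∀ {ps} → length ps ≤ n →
    Σ≤ n (λ r → 𝟙 (does (r ∉? ps) ∧ (length ps ≡ᵇ r))) ≡ 𝟙 (does (length ps ∉? ps))
  split-by-length {ps} l≤n = begin
    Σ≤ n (λ r → 𝟙 (does (r ∉? ps) ∧ (length ps ≡ᵇ r)))
      ≡⟨ Σ≤-cong n (λ r → 𝟙-∧ (does (r ∉? ps)) (length ps ≡ᵇ r)) ⟩
    Σ≤ n (λ r → if length ps ≡ᵇ r then 𝟙 (does (r ∉? ps)) else + 0)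
      ≡⟨ Σ≤-δ n (length ps) (λ r → 𝟙 (does (r ∉? ps))) ⟩
    (if length ps ≤ᵇ n then 𝟙 (does (length ps ∉? ps)) else + 0)
      ≡⟨ cong (if_then 𝟙 (does (length ps ∉? ps)) else + 0) (≤⇒≤ᵇ≡true l≤n) ⟩
    𝟙 (does (length ps ∉? ps)) ∎

theorem1p2 : (n : ℕ) (L : List (List ℕ)) → Unique L →
    (∀ ps → (ps ∈ L) ⇔ NonRascoe n ps) →
    (+ length L ≡ (negPochInf 1 ⊛ σ₂) n) × (+ length L ≡ rhs n)
theorem1p2 n L L-unique L⇔ = trans count (sym (negPochInf-⊛-σ₂ n)) , count
  where
  L⇔nonRascoe : ∀ ps → (ps ∈ L) ⇔ (ps ∈ nonRascoePartitions n)
  L⇔nonRascoe ps = ⇔-trans (L⇔ ps) (⇔-sym (∈-nonRascoePartitions n ps))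
  count : + length L ≡ rhs n
  count = begin
    + length L                        ≡⟨ cong +_ (length-unique-⇔ L-unique (nonRascoePartitions-unique n) L⇔nonRascoe) ⟩
    + length (nonRascoePartitions n)  ≡⟨ length-nonRascoePartitions n ⟩
    Σ≤ n (λ r → #dp∌ r n r n)         ≡⟨ Σ-#dp∌≡rhs n ⟩
    rhs n                             ∎
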